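{- Let $n\ge 6$, with vertex labels taken modulo $n$. Let $T$ be a 2-triangulation of a convex $n$-gon that does not contain the diagonal joining $a$ and $a+3$. Then $\deg(a+1)\neq 0$ and $\deg(a+2)\neq 0$.
   Context: The vertices of the convex $n$-gon are labeled $1,\dots,n$ clockwise (labels modulo $n$). Two diagonals cross if they intersect in their interiors. A 2-triangulation is a maximal set of diagonals no three of which pairwise cross. A diagonal joining two vertices at cyclic distance $2$ is called trivial (every 2-triangulation contains all of them). The degree $\deg(v)$ of a vertex $v$ in $T$ is the number of nontrivial diagonals of $T$ having $v$ as an endpoint. -}

module Defs where

open import Data.Nat using (ℕ; _<_; _≤_; _∸_; _+_; _⊓_; ∣_-_∣; _≡ᵇ_; NonZero)
open import Data.Nat.DivMod using (_mod_)
open import Data.Fin using (Fin; toℕ)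
open import Data.Bool using (Bool; true; _∧_; _∨_; not)
open import Data.List using (List; length; filterᵇ; allFin; cartesianProduct)
open import Data.Product using (_×_; _,_; ∃₂)
open import Data.Sum using (_⊎_)
open import Relation.Binary.PropositionalEquality using (_≡_)
open import Relation.Nullary using (¬_)

-- Vertices of the convex n-gon are Fin n (labels 0,…,n-1, in clockwise order).
-- Vertex a+k (labels modulo n):
shift : (n : ℕ) .{{_ : NonZero n}} → Fin n → ℕ → Fin n
shift n a k = (toℕ a + k) mod n

cdist : (n : ℕ) → Fin n → Fin n → ℕ
cdist n i j = ∣ toℕ i - toℕ j ∣ ⊓ (n ∸ ∣ toℕ i - toℕ j ∣)

Seg : ℕ → Set
Seg n = Fin n × Fin n

IsDiagonal : (n : ℕ) → Seg n → Set
IsDiagonal n (i , j) = (toℕ i < toℕ j) × (2 ≤ cdist n i j)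

nontrivialᵇ : (n : ℕ) → Fin n → Fin n → Bool
nontrivialᵇ n i j = not (cdist n i j ≡ᵇ 2)

Cross : {n : ℕ} → Seg n → Seg n → Set
Cross (i , j) (k , l) =
  (toℕ i < toℕ k × toℕ k < toℕ j × toℕ j < toℕ l)
  ⊎ (toℕ k < toℕ i × toℕ i < toℕ l × toℕ l < toℕ j)

DiagSet : ℕ → Set
DiagSet n = Fin n → Fin n → Bool

_∈D_ : {n : ℕ} → Seg n → DiagSet n → Set
(i , j) ∈D T = T i j ≡ true

ThreeCross : {n : ℕ} → Seg n → Seg n → Seg n → Set
ThreeCross d e f = Cross d e × Cross e f × Cross d f

Is2Triangulation : (n : ℕ) → DiagSet n → Set
Is2Triangulation n T =
  (∀ d → d ∈D T → IsDiagonal n d)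
  × (∀ d e f → d ∈D T → e ∈D T → f ∈D T → ¬ ThreeCross d e f)
  × (∀ d → IsDiagonal n d → ¬ (d ∈D T) →
       ∃₂ λ e f → e ∈D T × f ∈D T × ThreeCross d e f)

Contains : {n : ℕ} → DiagSet n → Fin n → Fin n → Set
Contains T u v = (T u v ≡ true) ⊎ (T v u ≡ true)

deg : (n : ℕ) → DiagSet n → Fin n → ℕ
deg n T v = length (filterᵇ test (cartesianProduct (allFin n) (allFin n)))
  where
  test : Seg n → Bool
  test (i , j) = T i j ∧ nontrivialᵇ n i j ∧ ((toℕ i ≡ᵇ toℕ v) ∨ (toℕ j ≡ᵇ toℕ v))

{-# OPTIONS --safe #-}
-- Since the diagonal d = {a, a+3} is missing, maximality gives diagonals e, f of T such
-- that d, e, f pairwise cross. A diagonal crossing d must have an endpoint on the short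
-- side of d, i.e. at a+1 or a+2, and crossing diagonals share no endpoint, so one of
-- e, f ends at a+1 and the other at a+2. Neither is trivial: every diagonal crossing a
-- trivial diagonal {m-1, m+1} ends at m, so no two of them cross, whereas e is crossed by
-- the crossing pair d, f and f by the crossing pair d, e.
module Submission where

open import Data.Bool.Properties using (T?; T-≡; T-not-≡; T-∧; T-∨; ¬-not)
open import Data.Empty using (⊥; ⊥-elim)
open import Data.Fin using (Fin; toℕ)
open import Data.Fin.Properties using (toℕ<n; toℕ-fromℕ<)
open import Data.List using (length)
open import Data.List.Membership.Propositional using (_∈_)
open import Data.List.Membership.Propositional.Properties
  using (∈-cartesianProduct⁺; ∈-allFin; ∈-filter⁺)
open import Data.List.Relation.Unary.Any using (here; there)
open import Data.Nat using (ℕ; zero; suc; _+_; _∸_; _≤_; _<_; _⊓_; ∣_-_∣; z≤n; s≤s; s≤s⁻¹; _<?_; NonZero)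
open import Data.Nat.DivMod using (_%_; m<n⇒m%n≡m; [m+n]%n≡m%n)
open import Data.Nat.Properties
open import Data.Product as Product using (_×_; _,_; proj₁; proj₂; ∃-syntax)
open import Data.Sum as Sum using (_⊎_; inj₁; inj₂; [_,_])
open import Function using (_∘_; Equivalence)
open import Relation.Binary.PropositionalEquality
  using (_≡_; _≢_; refl; sym; trans; cong; subst; module ≡-Reasoning)
open import Relation.Nullary using (¬_; yes; no)

open import Defs

open Equivalence using (from)

strictly-between-+2 : ∀ {u y} → u < y → y < u + 2 → y ≡ u + 1
strictly-between-+2 {u} {y} u<y y<u+2 =
  ≤-antisym (s≤s⁻¹ (subst (y <_) (+-suc u 1) y<u+2)) (subst (_≤ y) (+-comm 1 u) u<y)

strictly-between-+3 : ∀ {u y} → u < y → y < u + 3 → y ≡ u + 1 ⊎ y ≡ u + 2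
strictly-between-+3 {zero}  {1}                 _ _ = inj₁ refl
strictly-between-+3 {zero}  {2}                 _ _ = inj₂ refl
strictly-between-+3 {zero}  {suc (suc (suc _))} _ (s≤s (s≤s (s≤s ())))
strictly-between-+3 {suc u} {suc y} (s≤s u<y) (s≤s y<u+3) =
  Sum.map (cong suc) (cong suc) (strictly-between-+3 u<y y<u+3)

data HasEndpoint {n : ℕ} (e : Seg n) (P : ℕ → Set) : Set where
  endpoint₁ : P (toℕ (proj₁ e)) → HasEndpoint e P
  endpoint₂ : P (toℕ (proj₂ e)) → HasEndpoint e P

endpoint-map : ∀ {n} {P Q : ℕ → Set} {e : Seg n} →
  (∀ {x} → P x → Q x) → HasEndpoint e P → HasEndpoint e Q
endpoint-map f (endpoint₁ p) = endpoint₁ (f p)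
endpoint-map f (endpoint₂ p) = endpoint₂ (f p)

hasEndpoint-⊎ : ∀ {n P Q} {e : Seg n} →
  HasEndpoint e (λ x → P x ⊎ Q x) → HasEndpoint e P ⊎ HasEndpoint e Q
hasEndpoint-⊎ (endpoint₁ (inj₁ p)) = inj₁ (endpoint₁ p)
hasEndpoint-⊎ (endpoint₁ (inj₂ q)) = inj₂ (endpoint₁ q)
hasEndpoint-⊎ (endpoint₂ (inj₁ p)) = inj₁ (endpoint₂ p)
hasEndpoint-⊎ (endpoint₂ (inj₂ q)) = inj₂ (endpoint₂ q)

hasEndpoint⇒⊎ : ∀ {n P} {i j : Fin n} → HasEndpoint (i , j) P → P (toℕ i) ⊎ P (toℕ j)
hasEndpoint⇒⊎ (endpoint₁ p) = inj₁ p
hasEndpoint⇒⊎ (endpoint₂ p) = inj₂ p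

cross-sym : ∀ {n} {d e : Seg n} → Cross d e → Cross e d
cross-sym = Sum.swap

cross⇒no-common-endpoint : ∀ {n x} {d e : Seg n} →
  Cross d e → HasEndpoint d (_≡ x) → HasEndpoint e (_≡ x) → ⊥
cross⇒no-common-endpoint (inj₁ order) = interleaved⇒disjoint order
  where
  interleaved⇒disjoint : ∀ {n x} {i j k l : Fin n} →
    toℕ i < toℕ k × toℕ k < toℕ j × toℕ j < toℕ l →
    HasEndpoint (i , j) (_≡ x) → HasEndpoint (k , l) (_≡ x) → ⊥
  interleaved⇒disjoint (i<k , _ , _) (endpoint₁ refl) (endpoint₁ k≡i) = <⇒≢ i<k (sym k≡i)
  interleaved⇒disjoint (i<k , k<j , j<l) (endpoint₁ refl) (endpoint₂ l≡i) =
    <⇒≢ (<-trans i<k (<-trans k<j j<l)) (sym l≡i)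
  interleaved⇒disjoint (_ , k<j , _) (endpoint₂ refl) (endpoint₁ k≡j) = <⇒≢ k<j k≡j
  interleaved⇒disjoint (_ , _ , j<l) (endpoint₂ refl) (endpoint₂ l≡j) = <⇒≢ j<l (sym l≡j)
cross⇒no-common-endpoint {d = d} {e} (inj₂ order) d∋x e∋x =
  cross⇒no-common-endpoint {d = e} {d} (inj₁ order) e∋x d∋x

cross⇒endpoints-split : ∀ {n v w} {e f : Seg n} → Cross e f →
  HasEndpoint e (λ x → x ≡ v ⊎ x ≡ w) → HasEndpoint f (λ x → x ≡ v ⊎ x ≡ w) →
  (HasEndpoint e (_≡ v) ⊎ HasEndpoint f (_≡ v)) × (HasEndpoint e (_≡ w) ⊎ HasEndpoint f (_≡ w))
cross⇒endpoints-split {v = v} {w} e✕f e∋v∨w f∋v∨w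
  with hasEndpoint-⊎ {P = _≡ v} {_≡ w} e∋v∨w | hasEndpoint-⊎ {P = _≡ v} {_≡ w} f∋v∨w
... | inj₁ e∋v | inj₁ f∋v = ⊥-elim (cross⇒no-common-endpoint e✕f e∋v f∋v)
... | inj₁ e∋v | inj₂ f∋w = inj₁ e∋v , inj₂ f∋w
... | inj₂ e∋w | inj₁ f∋v = inj₂ f∋v , inj₁ e∋w
... | inj₂ e∋w | inj₂ f∋w = ⊥-elim (cross⇒no-common-endpoint e✕f e∋w f∋w)

Trivial : {n : ℕ} → Seg n → Set
Trivial {n} (i , j) = cdist n i j ≡ 2

∈⇒length≢0 : ∀ {A : Set} {x : A} {xs} → x ∈ xs → length xs ≢ 0
∈⇒length≢0 (here _)  ()
∈⇒length≢0 (there _) ()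

deg≢0 : ∀ {n} {D : DiagSet n} {v} {e : Seg n} →
  e ∈D D → ¬ Trivial e → HasEndpoint e (_≡ toℕ v) → deg n D v ≢ 0
deg≢0 {e = i , j} e∈D nontrivial e∋v =
  ∈⇒length≢0 (∈-filter⁺ (T? ∘ _) (∈-cartesianProduct⁺ (∈-allFin i) (∈-allFin j))
    (from T-∧ (from T-≡ e∈D , from T-∧ (from T-not-≡ (¬-not (nontrivial ∘ ≡ᵇ⇒≡ _ 2 ∘ from T-≡)) ,
      from T-∨ (Sum.map (≡⇒≡ᵇ _ _) (≡⇒≡ᵇ _ _) (hasEndpoint⇒⊎ e∋v))))))

module _ {n : ℕ} .{{_ : NonZero n}} where

  [n+m]%n≡m%n : ∀ m → (n + m) % n ≡ m % n
  [n+m]%n≡m%n m = trans (cong (_% n) (+-comm n m)) ([m+n]%n≡m%n m n)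

  n+m%n≡m : ∀ {m} → n ≤ m → m < n + n → n + m % n ≡ m
  n+m%n≡m n≤m m<n+n with r , refl ← m≤n⇒∃[o]m+o≡n n≤m =
    cong (n +_) (trans ([n+m]%n≡m%n r) (m<n⇒m%n≡m (+-cancelˡ-< n r n m<n+n)))

  toℕ-shift : ∀ (a : Fin n) k → toℕ (shift n a k) ≡ (toℕ a + k) % n
  toℕ-shift a k = toℕ-fromℕ< _

  toℕ-shift-< : ∀ (a : Fin n) k → toℕ a + k < n → toℕ (shift n a k) ≡ toℕ a + k
  toℕ-shift-< a k a+k<n = trans (toℕ-shift a k) (m<n⇒m%n≡m a+k<n)

  toℕ-shift-≥ : ∀ (a : Fin n) {k} → k ≤ n → n ≤ toℕ a + k → n + toℕ (shift n a k) ≡ toℕ a + k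
  toℕ-shift-≥ a {k} k≤n n≤a+k =
    trans (cong (n +_) (toℕ-shift a k)) (n+m%n≡m n≤a+k (+-mono-<-≤ (toℕ<n a) k≤n))

  -- Positions are lifted to ℕ so that an arc of the polygon passing through vertex 0
  -- is still an interval u < y < w.
  Between : ℕ → ℕ → ℕ → Set
  Between u w x = ∃[ y ] (u < y × y < w × x ≡ y % n)

  between-+2 : ∀ {u x} → Between u (u + 2) x → x ≡ (u + 1) % n
  between-+2 (y , u<y , y<u+2 , x≡y%n) with refl ← strictly-between-+2 u<y y<u+2 = x≡y%n

  between-a-a+3 : ∀ (a : Fin n) {x} → Between (toℕ a) (toℕ a + 3) x →
    x ≡ toℕ (shift n a 1) ⊎ x ≡ toℕ (shift n a 2)
  between-a-a+3 a (y , a<y , y<a+3 , x≡y%n) with strictly-between-+3 a<y y<a+3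
  ... | inj₁ refl = inj₁ (trans x≡y%n (sym (toℕ-shift a 1)))
  ... | inj₂ refl = inj₂ (trans x≡y%n (sym (toℕ-shift a 2)))

  cross⇒endpoint-inside : ∀ {i j : Fin n} {e : Seg n} →
    Cross (i , j) e → HasEndpoint e (Between (toℕ i) (toℕ j))
  cross⇒endpoint-inside {e = k , _} (inj₁ (i<k , k<j , _)) =
    endpoint₁ (toℕ k , i<k , k<j , sym (m<n⇒m%n≡m (toℕ<n k)))
  cross⇒endpoint-inside {e = _ , l} (inj₂ (_ , i<l , l<j)) =
    endpoint₂ (toℕ l , i<l , l<j , sym (m<n⇒m%n≡m (toℕ<n l)))

  cross⇒endpoint-outside : ∀ {i j : Fin n} {e : Seg n} →
    Cross (i , j) e → HasEndpoint e (Between (toℕ j) (n + toℕ i))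
  cross⇒endpoint-outside {i} {e = _ , l} (inj₁ (_ , _ , j<l)) =
    endpoint₂ (toℕ l , j<l , <-≤-trans (toℕ<n l) (m≤m+n n (toℕ i)) , sym (m<n⇒m%n≡m (toℕ<n l)))
  cross⇒endpoint-outside {j = j} {e = k , _} (inj₂ (k<i , _ , _)) =
    endpoint₁ (n + toℕ k , <-≤-trans (toℕ<n j) (m≤m+n n (toℕ k)) , +-monoʳ-< n k<i ,
               sym (trans ([n+m]%n≡m%n (toℕ k)) (m<n⇒m%n≡m (toℕ<n k))))

  cdist-gap : ∀ {i j : Fin n} {g} → toℕ i + g ≡ toℕ j → cdist n i j ≡ g ⊓ (n ∸ g)
  cdist-gap {i} {g = g} i+g≡j =
    cong (λ δ → δ ⊓ (n ∸ δ)) (trans (cong (∣ toℕ i -_∣) (sym i+g≡j)) (∣m-m+n∣≡n (toℕ i) g))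

  gap⇒isDiagonal : ∀ {i j : Fin n} {g} → 2 ≤ g → 2 ≤ n ∸ g → toℕ i + g ≡ toℕ j →
    IsDiagonal n (i , j)
  gap⇒isDiagonal {i} 2≤g 2≤n∸g i+g≡j =
    subst (toℕ i <_) i+g≡j (m<m+n (toℕ i) (≤-trans (s≤s z≤n) 2≤g)) ,
    subst (2 ≤_) (sym (cdist-gap i+g≡j)) (⊓-glb 2≤g 2≤n∸g)

  trivial⇒width-2 : ∀ {i j : Fin n} → IsDiagonal n (i , j) → Trivial (i , j) →
    toℕ i + 2 ≡ toℕ j ⊎ toℕ j + 2 ≡ n + toℕ i
  trivial⇒width-2 {i} {j} (i<j , _) trivial
    with g , i+g≡j ← m≤n⇒∃[o]m+o≡n (<⇒≤ i<j)
    with ⊓-sel g (n ∸ g)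
  ... | inj₁ min≡g = inj₁ (subst (λ t → toℕ i + t ≡ toℕ j) g≡2 i+g≡j)
    where
    g≡2 : g ≡ 2
    g≡2 = trans (sym min≡g) (trans (sym (cdist-gap i+g≡j)) trivial)
  ... | inj₂ min≡n∸g = inj₂ (begin
    toℕ j + 2              ≡⟨ cong (_+ 2) (sym i+g≡j) ⟩
    toℕ i + g + 2          ≡⟨ +-assoc (toℕ i) g 2 ⟩
    toℕ i + (g + 2)        ≡⟨ cong (λ t → toℕ i + (g + t)) (sym n∸g≡2) ⟩
    toℕ i + (g + (n ∸ g))  ≡⟨ cong (toℕ i +_) (m+[n∸m]≡n g≤n) ⟩
    toℕ i + n              ≡⟨ +-comm (toℕ i) n ⟩
    n + toℕ i              ∎)
    where
    open ≡-Reasoning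
    n∸g≡2 : n ∸ g ≡ 2
    n∸g≡2 = trans (sym min≡n∸g) (trans (sym (cdist-gap i+g≡j)) trivial)
    g≤n : g ≤ n
    g≤n = ≤-trans (subst (g ≤_) i+g≡j (m≤n+m g (toℕ i))) (<⇒≤ (toℕ<n j))

  trivial⇒crossers-share-endpoint : ∀ {d : Seg n} → IsDiagonal n d → Trivial d →
    ∃[ m ] (∀ {e : Seg n} → Cross d e → HasEndpoint e (_≡ m))
  trivial⇒crossers-share-endpoint {i , j} d-diagonal trivial
    with trivial⇒width-2 d-diagonal trivial
  ... | inj₁ i+2≡j = (toℕ i + 1) % n , λ {e} →
    endpoint-map between-+2 ∘ subst (HasEndpoint e ∘ Between (toℕ i)) (sym i+2≡j)
      ∘ cross⇒endpoint-inside
  ... | inj₂ j+2≡n+i = (toℕ j + 1) % n , λ {e} →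
    endpoint-map between-+2 ∘ subst (HasEndpoint e ∘ Between (toℕ j)) (sym j+2≡n+i)
      ∘ cross⇒endpoint-outside

  crossed-by-crossing-pair⇒nontrivial : ∀ {g d e : Seg n} → IsDiagonal n g →
    Cross g d → Cross g e → Cross d e → ¬ Trivial g
  crossed-by-crossing-pair⇒nontrivial g-diagonal g✕d g✕e d✕e trivial
    with m , crossers∋m ← trivial⇒crossers-share-endpoint g-diagonal trivial =
    cross⇒no-common-endpoint d✕e (crossers∋m g✕d) (crossers∋m g✕e)

  chord : Fin n → ℕ → Seg n
  chord a k with toℕ a + k <? n
  ... | yes _ = a , shift n a k
  ... | no  _ = shift n a k , a

  chord∈⇒contains : ∀ {D : DiagSet n} (a : Fin n) k → chord a k ∈D D → Contains D a (shift n a k)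
  chord∈⇒contains a k with toℕ a + k <? n
  ... | yes _ = inj₁
  ... | no  _ = inj₂

  chord-isDiagonal : ∀ (a : Fin n) {k} → 2 ≤ k → 2 ≤ n ∸ k → IsDiagonal n (chord a k)
  chord-isDiagonal a {k} 2≤k 2≤n∸k with toℕ a + k <? n
  ... | yes a+k<n = gap⇒isDiagonal 2≤k 2≤n∸k (sym (toℕ-shift-< a k a+k<n))
  ... | no  a+k≮n = gap⇒isDiagonal 2≤n∸k (subst (2 ≤_) (sym (m∸[m∸n]≡n k≤n)) 2≤k) (begin
    toℕ (shift n a k) + (n ∸ k)  ≡⟨ sym (+-∸-assoc (toℕ (shift n a k)) k≤n) ⟩
    toℕ (shift n a k) + n ∸ k    ≡⟨ cong (_∸ k) (+-comm (toℕ (shift n a k)) n) ⟩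
    n + toℕ (shift n a k) ∸ k    ≡⟨ cong (_∸ k) (toℕ-shift-≥ a k≤n (≮⇒≥ a+k≮n)) ⟩
    toℕ a + k ∸ k                ≡⟨ m+n∸n≡m (toℕ a) k ⟩
    toℕ a                        ∎)
    where
    open ≡-Reasoning
    k≤n : k ≤ n
    k≤n = <⇒≤ (m∸n≢0⇒n<m (>⇒≢ (≤-trans (s≤s z≤n) 2≤n∸k)))

  cross-chord⇒endpoint-between : ∀ (a : Fin n) {k} {e : Seg n} → k ≤ n →
    Cross (chord a k) e → HasEndpoint e (Between (toℕ a) (toℕ a + k))
  cross-chord⇒endpoint-between a {k} {e} k≤n with toℕ a + k <? n
  ... | yes a+k<n =
    subst (HasEndpoint e ∘ Between (toℕ a)) (toℕ-shift-< a k a+k<n) ∘ cross⇒endpoint-inside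
  ... | no  a+k≮n =
    subst (HasEndpoint e ∘ Between (toℕ a)) (toℕ-shift-≥ a k≤n (≮⇒≥ a+k≮n)) ∘ cross⇒endpoint-outside

  cross-chord-3⇒endpoint-a+1-or-a+2 : ∀ (a : Fin n) {e : Seg n} → 3 ≤ n → Cross (chord a 3) e →
    HasEndpoint e (λ x → x ≡ toℕ (shift n a 1) ⊎ x ≡ toℕ (shift n a 2))
  cross-chord-3⇒endpoint-a+1-or-a+2 a 3≤n =
    endpoint-map (between-a-a+3 a) ∘ cross-chord⇒endpoint-between a 3≤n

lemma3p3 : (n : ℕ) .{{_ : NonZero n}} → 6 ≤ n → (T : DiagSet n) → Is2Triangulation n T →
    (a : Fin n) → ¬ Contains T a (shift n a 3) →
    (deg n T (shift n a 1) ≢ 0) × (deg n T (shift n a 2) ≢ 0)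
lemma3p3 n 6≤n T (diagonals , _ , maximal) a a≁a+3
  with maximal (chord a 3)
                (chord-isDiagonal a (s≤s (s≤s z≤n)) (≤-trans (s≤s (s≤s z≤n)) (∸-monoˡ-≤ 3 6≤n)))
                (a≁a+3 ∘ chord∈⇒contains {D = T} a 3)
... | e , f , e∈T , f∈T , d✕e , e✕f , d✕f =
  Product.map covered covered (cross⇒endpoints-split e✕f
    (cross-chord-3⇒endpoint-a+1-or-a+2 a 3≤n d✕e) (cross-chord-3⇒endpoint-a+1-or-a+2 a 3≤n d✕f))
  where
  3≤n : 3 ≤ n
  3≤n = ≤-trans (s≤s (s≤s (s≤s z≤n))) 6≤n
  e-nontrivial : ¬ Trivial e
  e-nontrivial = crossed-by-crossing-pair⇒nontrivial (diagonals e e∈T) (cross-sym d✕e) e✕f d✕f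
  f-nontrivial : ¬ Trivial f
  f-nontrivial = crossed-by-crossing-pair⇒nontrivial (diagonals f f∈T) (cross-sym d✕f) (cross-sym e✕f) d✕e
  covered : ∀ {v} → HasEndpoint e (_≡ toℕ v) ⊎ HasEndpoint f (_≡ toℕ v) → deg n T v ≢ 0
  covered = [ deg≢0 {D = T} e∈T e-nontrivial , deg≢0 {D = T} f∈T f-nontrivial ]
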